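{- For any vertex $R=(A-2^{ -1}C\Delta C^t\ \ I^{(\nu)}\ \ C)$ of $\Lambda$ (with $A$ a $\nu\times\nu$ alternate matrix and $C\in M_{\nu 2}(\mathbb{F}_q)$), the neighborhood of $R$ in $\Lambda$ is $$ \Lambda(R)=\{(A-2^{ -1}(C\Delta C^t+D\Delta D^t+2D\Delta C^t)\ \ I^{(\nu)}\ \ C+D)\,|\,D \in M_{\nu 2}(\mathbb{F}_q),\,\,\mathrm{rank}\,D=1\}. $$
   Context: Let $\mathbb{F}_q$ be a finite field with $q$ odd, $z$ a fixed non-square in $\mathbb{F}_q$ with $1-z$ also a non-square, and $\Delta=\mathrm{diag}(1,-z)$. Consider the orthogonal space $\mathbb{F}_q^{2\nu+2}$ with respect to $S=\begin{pmatrix}0&I^{(\nu)}&\\ I^{(\nu)}&0&\\ &&\Delta\end{pmatrix}$ (where $I^{(\nu)}$ is the $\nu\times\nu$ identity matrix), and the orthogonal dual polar graph whose vertices are the maximal ($\nu$-dimensional) totally isotropic subspaces, two being adjacent iff their intersection has dimension $\nu-1$. $\Lambda$ is the last subconstituent with respect to the vertex $(I^{(\nu)}\ 0^{(\nu)}\ 0^{(\nu,2)})$; it consists of the subspaces with matrix representation $(X\ \ I^{(\nu)}\ \ Z)$ with $X\in M_\nu(\mathbb{F}_q)$, $Z\in M_{\nu 2}(\mathbb{F}_q)$, $X+X^t+Z\Delta Z^t=0$; equivalently every element has the form $(A-2^{ -1}C\Delta C^t\ \ I^{(\nu)}\ \ C)$ with $A$ alternate. $\Lambda(R)$ denotes the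 set of neighbors of $R$ in the induced subgraph on $\Lambda$ (two such vertices are adjacent iff the difference of their representations $(X\ Z)$ has rank 1). -}

module Defs where

open import Level using (0ℓ)
open import Algebra.Bundles using (CommutativeRing)
open import Data.Nat using (ℕ)
open import Data.Fin using (Fin; zero; suc)
import Data.Fin
import Data.Sum
import Data.Nat
open import Data.Product using (Σ; ∃; _×_; _,_)
open import Relation.Nullary using (¬_)
open import Relation.Binary.PropositionalEquality using (_≡_)

module Setup (R : CommutativeRing 0ℓ 0ℓ) where
  open CommutativeRing R hiding (zero)

  IsField : Set
  IsField = ¬ (0# ≈ 1#) × (∀ x → ¬ (x ≈ 0#) → ∃ λ y → x * y ≈ 1#)

  HasOrder : ℕ → Set
  HasOrder q = Σ (Fin q → Carrier) λ f →
                 (∀ i j → f i ≈ f j → i ≡ j) × (∀ x → ∃ λ i → f i ≈ x)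

  Odd : ℕ → Set
  Odd q = ∃ λ k → q ≡ ℕ.suc (2 Data.Nat.* k)

  IsFiniteFieldOddOrder : Set
  IsFiniteFieldOddOrder = IsField × (∃ λ q → Odd q × HasOrder q)

  NonSquare : Carrier → Set
  NonSquare x = ¬ (∃ λ y → y * y ≈ x)

  Mat : ℕ → ℕ → Set
  Mat m n = Fin m → Fin n → Carrier

  Σ[_] : ∀ {n} → (Fin n → Carrier) → Carrier
  Σ[_] {ℕ.zero}  f = 0#
  Σ[_] {ℕ.suc n} f = f zero + Σ[ (λ i → f (suc i)) ]

  _⊕_ : ∀ {m n} → Mat m n → Mat m n → Mat m n
  (M ⊕ N) i j = M i j + N i j

  _⊖_ : ∀ {m n} → Mat m n → Mat m n → Mat m n
  (M ⊖ N) i j = M i j - N i j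

  _⊛_ : ∀ {m n} → Carrier → Mat m n → Mat m n
  (c ⊛ M) i j = c * M i j

  _⊗_ : ∀ {m n p} → Mat m n → Mat n p → Mat m p
  (M ⊗ N) i k = Σ[ (λ j → M i j * N j k) ]

  _ᵗ : ∀ {m n} → Mat m n → Mat n m
  (M ᵗ) i j = M j i

  _≋_ : ∀ {m n} → Mat m n → Mat m n → Set
  M ≋ N = ∀ i j → M i j ≈ N i j

  [_∣_] : ∀ {m n p} → Mat m n → Mat m p → Mat m (n Data.Nat.+ p)
  [_∣_] {n = n} X Z i j with Data.Fin.splitAt n j
  ... | Data.Sum.inj₁ a = X i a
  ... | Data.Sum.inj₂ b = Z i b

  Δ : Carrier → Mat 2 2
  Δ z zero    zero    = 1#
  Δ z zero    (suc _) = 0#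
  Δ z (suc _) zero    = 0#
  Δ z (suc _) (suc _) = - z

  Alternate : ∀ {n} → Mat n n → Set
  Alternate A = (∀ i j → A j i ≈ - A i j) × (∀ i → A i i ≈ 0#)

  LinIndep : ∀ {k m} → (Fin k → Fin m → Carrier) → Set
  LinIndep {k} {m} v = ∀ (c : Fin k → Carrier) →
    (∀ i → Σ[ (λ j → c j * v j i) ] ≈ 0#) → ∀ j → c j ≈ 0#

  Rank : ∀ {m n} → Mat m n → ℕ → Set
  Rank {m} {n} M r =
    (∃ λ (s : Fin r → Fin n) → LinIndep (λ a i → M i (s a))) ×
    (∀ (s : Fin (ℕ.suc r) → Fin n) → ¬ LinIndep (λ a i → M i (s a)))

  -- (X Z) represents a vertex of Λ: X + X^t + Z Δ Z^t = 0
  InΛ : Carrier → ∀ {ν} → Mat ν ν → Mat ν 2 → Set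
  InΛ z X Z = ((X ⊕ (X ᵗ)) ⊕ ((Z ⊗ Δ z) ⊗ (Z ᵗ))) ≋ (λ _ _ → 0#)

  Adj : ∀ {ν} → Mat ν ν → Mat ν 2 → Mat ν ν → Mat ν 2 → Set
  Adj X Z X' Z' = Rank [ X ⊖ X' ∣ Z ⊖ Z' ] 1

  InΛR : Carrier → ∀ {ν} → Mat ν ν → Mat ν 2 → Mat ν ν → Mat ν 2 → Set
  InΛR z XR ZR X Z = InΛ z X Z × Adj X Z XR ZR

-- Write a neighbour of R = (Xᴿ I C) in Λ as (X I C + D), and let X⁺ D be the first block
-- predicted by the lemma. Over a field, (X - Xᴿ , D) has rank one iff it is nonzero and all
-- its 2 × 2 minors vanish.
-- If X = X⁺ D, then (X - Xᴿ , D) = D (N ∣ I) for an explicit N, so it has rank one together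
-- with D, and a direct computation puts (X⁺ D , C + D) in Λ.
-- Conversely, E = X - X⁺ D is skew-symmetric, because X and X⁺ D satisfy the equation of Λ
-- with the same Z, and each row of E is a linear function of the corresponding row of the
-- rank-one matrix (X - Xᴿ , D), so E = u μᵗ. A skew-symmetric outer product vanishes once 2
-- is invertible; hence X = X⁺ D, and D inherits rank one from (X - Xᴿ , D).
module Submission where

open import Defs
open import Level using (0ℓ)
open import Algebra.Bundles using (CommutativeRing)
open import Data.Nat using (ℕ)
open import Data.Product using (∃; _×_)
open import Function.Bundles using (_⇔_)

open import Data.Nat using (suc)
import Data.Nat as ℕ
import Data.Nat.Properties as ℕ
open import Data.Integer using (ℤ; +_; -[1+_])
import Data.Integer as ℤ
import Data.Integer.Properties as ℤ
open import Data.Sign as Sign using (Sign)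
open import Data.Maybe using (Maybe; just; nothing)
open import Data.Fin using (Fin; _↑ˡ_; _↑ʳ_; splitAt)
import Data.Fin as Fin
import Data.Fin.Properties as Fin
open import Data.Fin.Patterns using (0F; 1F)
open import Data.Vec.Functional using ([]; _∷_)
open import Data.Sum using (inj₁; inj₂)
open import Data.Product using (∃₂; _,_; proj₁; proj₂)
open import Data.Empty using (⊥-elim)
open import Function.Bundles using (mk⇔; Equivalence)
open import Relation.Nullary using (¬_; Dec; yes; no)
open import Relation.Binary.PropositionalEquality as ≡ using (_≡_)
import Algebra.Solver.Ring.AlmostCommutativeRing as ACR

-- Algebra.Solver.Ring needs a coefficient ring with decidable equality; we use ℤ.
module IntegerCoefficientSolver (R : CommutativeRing 0ℓ 0ℓ) where
  open CommutativeRing R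
  open import Algebra.Properties.Semiring.Mult semiring using (×-homo-+; ×1-homo-*) renaming (_×_ to _·_)
  open import Algebra.Properties.Ring ring using (-‿involutive; -0#≈0#; -‿+-comm; -‿distribˡ-*; -‿distribʳ-*)
  open import Relation.Binary.Reasoning.Setoid setoid

  fromℕ : ℕ → Carrier
  fromℕ n = n · 1#

  fromℤ : ℤ → Carrier
  fromℤ (+ n)    = fromℕ n
  fromℤ -[1+ n ] = - fromℕ (suc n)

  signed : Sign → Carrier → Carrier
  signed Sign.+ x = x
  signed Sign.- x = - x

  signed-cong : ∀ s {x y} → x ≈ y → signed s x ≈ signed s y
  signed-cong Sign.+ e = e
  signed-cong Sign.- e = -‿cong e

  signed-* : ∀ s t x y → signed (s Sign.* t) (x * y) ≈ signed s x * signed t y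
  signed-* Sign.+ Sign.+ x y = refl
  signed-* Sign.+ Sign.- x y = -‿distribʳ-* x y
  signed-* Sign.- Sign.+ x y = -‿distribˡ-* x y
  signed-* Sign.- Sign.- x y = begin
    x * y           ≈⟨ *-cong (sym (-‿involutive x)) refl ⟩
    - - x * y       ≈⟨ -‿distribˡ-* (- x) y ⟨
    - (- x * y)     ≈⟨ -‿distribʳ-* (- x) y ⟩
    - x * - y       ∎

  fromℤ-◃ : ∀ s n → fromℤ (s ℤ.◃ n) ≈ signed s (fromℕ n)
  fromℤ-◃ Sign.+ 0       = refl
  fromℤ-◃ Sign.- 0       = sym -0#≈0#
  fromℤ-◃ Sign.+ (suc n) = refl
  fromℤ-◃ Sign.- (suc n) = refl

  fromℤ-signAbs : ∀ i → fromℤ i ≈ signed (ℤ.sign i) (fromℕ ℤ.∣ i ∣)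
  fromℤ-signAbs (+ n)    = refl
  fromℤ-signAbs -[1+ n ] = refl

  -‿+-cancelˡ : ∀ w x y → x - y ≈ (w + x) - (w + y)
  -‿+-cancelˡ w x y = begin
    x - y                   ≈⟨ +-identityˡ (x - y) ⟨
    0# + (x - y)            ≈⟨ +-cong (-‿inverseʳ w) refl ⟨
    (w - w) + (x - y)       ≈⟨ +-assoc w (- w) (x - y) ⟩
    w + (- w + (x - y))     ≈⟨ +-cong refl (+-assoc (- w) x (- y)) ⟨
    w + ((- w + x) - y)     ≈⟨ +-cong refl (+-cong (+-comm (- w) x) refl) ⟩
    w + ((x - w) - y)       ≈⟨ +-cong refl (+-assoc x (- w) (- y)) ⟩
    w + (x + (- w - y))     ≈⟨ +-assoc w x (- w - y) ⟨
    (w + x) + (- w - y)     ≈⟨ +-cong refl (-‿+-comm w y) ⟩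
    (w + x) - (w + y)       ∎

  fromℤ-⊖ : ∀ m n → fromℤ (m ℤ.⊖ n) ≈ fromℕ m - fromℕ n
  fromℤ-⊖ m       0       = trans (sym (+-identityʳ (fromℕ m))) (+-cong refl (sym -0#≈0#))
  fromℤ-⊖ 0       (suc n) = sym (+-identityˡ _)
  fromℤ-⊖ (suc m) (suc n) rewrite ℤ.[1+m]⊖[1+n]≡m⊖n m n =
    trans (fromℤ-⊖ m n) (-‿+-cancelˡ 1# (fromℕ m) (fromℕ n))

  fromℤ-+ : ∀ i j → fromℤ (i ℤ.+ j) ≈ fromℤ i + fromℤ j
  fromℤ-+ (+ m)    (+ n)    = ×-homo-+ 1# m n
  fromℤ-+ (+ m)    -[1+ n ] = fromℤ-⊖ m (suc n)
  fromℤ-+ -[1+ m ] (+ n)    = trans (fromℤ-⊖ n (suc m)) (+-comm _ _)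
  fromℤ-+ -[1+ m ] -[1+ n ] = begin
    - fromℕ (suc (suc (m ℕ.+ n)))  ≡⟨ ≡.cong (λ k → - fromℕ (suc k)) (ℕ.+-suc m n) ⟨
    - fromℕ (suc m ℕ.+ suc n)      ≈⟨ -‿cong (×-homo-+ 1# (suc m) (suc n)) ⟩
    - (fromℕ (suc m) + fromℕ (suc n)) ≈⟨ -‿+-comm _ _ ⟨
    - fromℕ (suc m) - fromℕ (suc n) ∎

  fromℤ-* : ∀ i j → fromℤ (i ℤ.* j) ≈ fromℤ i * fromℤ j
  fromℤ-* i j = begin
    fromℤ (i ℤ.* j)                       ≈⟨ fromℤ-◃ (s Sign.* t) (ℤ.∣ i ∣ ℕ.* ℤ.∣ j ∣) ⟩
    signed (s Sign.* t) (fromℕ (ℤ.∣ i ∣ ℕ.* ℤ.∣ j ∣))   ≈⟨ signed-cong (s Sign.* t) (×1-homo-* ℤ.∣ i ∣ ℤ.∣ j ∣) ⟩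
    signed (s Sign.* t) (fromℕ ℤ.∣ i ∣ * fromℕ ℤ.∣ j ∣) ≈⟨ signed-* s t _ _ ⟩
    signed s (fromℕ ℤ.∣ i ∣) * signed t (fromℕ ℤ.∣ j ∣) ≈⟨ *-cong (fromℤ-signAbs i) (fromℤ-signAbs j) ⟨
    fromℤ i * fromℤ j                     ∎
    where s = ℤ.sign i; t = ℤ.sign j

  fromℤ-neg : ∀ i → fromℤ (ℤ.- i) ≈ - fromℤ i
  fromℤ-neg (+ 0)       = sym -0#≈0#
  fromℤ-neg (+ suc n)   = refl
  fromℤ-neg -[1+ n ]    = sym (-‿involutive _)

  fromℤ-homomorphism : ACR._-Raw-AlmostCommutative⟶_ ℤ.+-*-rawRing (ACR.fromCommutativeRing R)
  fromℤ-homomorphism = record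
    { ⟦_⟧ = fromℤ ; +-homo = fromℤ-+ ; *-homo = fromℤ-* ; -‿homo = fromℤ-neg
    ; 0-homo = refl ; 1-homo = +-identityʳ 1# }

  fromℤ-≟ : ∀ i j → Maybe (fromℤ i ≈ fromℤ j)
  fromℤ-≟ i j with i ℤ.≟ j
  ... | yes ≡.refl = just refl
  ... | no _     = nothing

  open import Algebra.Solver.Ring ℤ.+-*-rawRing (ACR.fromCommutativeRing R) fromℤ-homomorphism fromℤ-≟ public

module Matrices (F : CommutativeRing 0ℓ 0ℓ) where
  open CommutativeRing F hiding (zero)
  open Setup F
  open IntegerCoefficientSolver F using (solve; _:=_; _:+_; _:*_; _:-_; :-_; con)
  open import Algebra.Properties.Ring ring
    using (-0#≈0#; -‿injective; x∙y⁻¹≈ε⇒x≈y; x≈y⇒x∙y⁻¹≈ε; +-inverseˡ-unique)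
  open import Relation.Binary.Reasoning.Setoid setoid

  0ᴹ : ∀ {m n} → Mat m n
  0ᴹ _ _ = 0#

  [∣]-↑ˡ : ∀ {m n p} (X : Mat m n) (Z : Mat m p) i a → [ X ∣ Z ] i (a ↑ˡ p) ≡ X i a
  [∣]-↑ˡ {n = n} {p} X Z i a rewrite Fin.splitAt-↑ˡ n a p = ≡.refl

  [∣]-↑ʳ : ∀ {m n p} (X : Mat m n) (Z : Mat m p) i b → [ X ∣ Z ] i (n ↑ʳ b) ≡ Z i b
  [∣]-↑ʳ {n = n} {p} X Z i b rewrite Fin.splitAt-↑ʳ n p b = ≡.refl

  Rank≤1 : ∀ {m n} → Mat m n → Set
  Rank≤1 M = ∀ i i' j j' → M i j * M i' j' ≈ M i' j * M i j'

  Rank≤1-resp-≋ : ∀ {m n} {M N : Mat m n} → M ≋ N → Rank≤1 M → Rank≤1 N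
  Rank≤1-resp-≋ {M = M} {N} M≋N r i i' j j' = begin
    N i j * N i' j'  ≈⟨ *-cong (M≋N i j) (M≋N i' j') ⟨
    M i j * M i' j'  ≈⟨ r i i' j j' ⟩
    M i' j * M i j'  ≈⟨ *-cong (M≋N i' j) (M≋N i j') ⟩
    N i' j * N i j'  ∎

  Rank≤1-columns : ∀ {m n k} {M : Mat m n} (f : Fin k → Fin n) → Rank≤1 M → Rank≤1 (λ i a → M i (f a))
  Rank≤1-columns f r i i' a a' = r i i' (f a) (f a')

  Rank≤1-⊗ : ∀ {m n} (D : Mat m 2) (N : Mat 2 n) → Rank≤1 D → Rank≤1 (D ⊗ N)
  Rank≤1-⊗ D N r i i' j j' = x∙y⁻¹≈ε⇒x≈y _ _ (begin
    (D ⊗ N) i j * (D ⊗ N) i' j' - (D ⊗ N) i' j * (D ⊗ N) i j'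
      ≈⟨ cauchy-binet (D i 0F) (D i 1F) (D i' 0F) (D i' 1F) (N 0F j) (N 1F j) (N 0F j') (N 1F j') ⟩
    (D i 0F * D i' 1F - D i' 0F * D i 1F) * (N 0F j * N 1F j' - N 1F j * N 0F j')
      ≈⟨ *-cong (x≈y⇒x∙y⁻¹≈ε (r i i' 0F 1F)) refl ⟩
    0# * (N 0F j * N 1F j' - N 1F j * N 0F j')
      ≈⟨ zeroˡ _ ⟩
    0# ∎)
    where
    cauchy-binet : ∀ a b c d p q r s →
      (a * p + (b * q + 0#)) * (c * r + (d * s + 0#)) - (c * p + (d * q + 0#)) * (a * r + (b * s + 0#))
      ≈ (a * d - c * b) * (p * s - q * r)
    cauchy-binet = solve 8 (λ a b c d p q r s →
      (a :* p :+ (b :* q :+ con (+ 0))) :* (c :* r :+ (d :* s :+ con (+ 0)))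
        :- (c :* p :+ (d :* q :+ con (+ 0))) :* (a :* r :+ (b :* s :+ con (+ 0)))
      := (a :* d :- c :* b) :* (p :* s :- q :* r)) refl

  minors≈⇒¬LinIndep : ¬ 0# ≈ 1# → ∀ {m} (v : Fin 2 → Fin m → Carrier) →
                      (∀ k l → v 0F k * v 1F l ≈ v 0F l * v 1F k) → ¬ LinIndep v
  minors≈⇒¬LinIndep 0≉1 v minor li = 0≉1 (sym (li (1# ∷ 0# ∷ []) first-only 0F))
    where
    first≈0 : ∀ k → v 0F k ≈ 0#
    first≈0 k = -‿injective (trans (li (v 1F k ∷ - v 0F k ∷ []) dependence 1F) (sym -0#≈0#))
      where
      dependence : ∀ i → v 1F k * v 0F i + (- v 0F k * v 1F i + 0#) ≈ 0#
      dependence i = trans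
        (solve 4 (λ a b c d → b :* a :+ (:- c :* d :+ con (+ 0)) := a :* b :- c :* d)
               refl (v 0F i) (v 1F k) (v 0F k) (v 1F i))
        (x≈y⇒x∙y⁻¹≈ε (minor i k))
    first-only : ∀ i → 1# * v 0F i + (0# * v 1F i + 0#) ≈ 0#
    first-only i = begin
      1# * v 0F i + (0# * v 1F i + 0#) ≈⟨ +-cong (*-cong refl (first≈0 i)) (+-identityʳ _) ⟩
      1# * 0# + 0# * v 1F i            ≈⟨ +-cong (zeroʳ 1#) (zeroˡ _) ⟩
      0# + 0#                          ≈⟨ +-identityʳ 0# ⟩
      0#                               ∎

  LinIndep-singleton⁻¹ : ¬ 0# ≈ 1# → ∀ {m} {v : Fin 1 → Fin m → Carrier} → LinIndep v → ¬ (∀ k → v 0F k ≈ 0#)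
  LinIndep-singleton⁻¹ 0≉1 li v≈0 =
    0≉1 (sym (li (λ _ → 1#) (λ k → trans (+-identityʳ _) (trans (*-identityˡ _) (v≈0 k))) 0F))

  x*2≈x+x : ∀ x → x * (1# + 1#) ≈ x + x
  x*2≈x+x x = trans (distribˡ x 1# 1#) (+-cong (*-identityʳ x) (*-identityʳ x))

  +-self≈0⇒≈0 : ∀ {h} → h + h ≈ 1# → ∀ {x} → x + x ≈ 0# → x ≈ 0#
  +-self≈0⇒≈0 {h} h+h≈1 {x} x+x≈0 = begin
    x             ≈⟨ *-identityˡ x ⟨
    1# * x        ≈⟨ *-cong h+h≈1 refl ⟨
    (h + h) * x   ≈⟨ solve 2 (λ h x → (h :+ h) :* x := h :* (x :+ x)) refl h x ⟩
    h * (x + x)   ≈⟨ *-cong refl x+x≈0 ⟩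
    h * 0#        ≈⟨ zeroʳ h ⟩
    0#            ∎

  module OverField (isField : IsField) (_≟_ : ∀ x y → Dec (x ≈ y)) where
    private
      0≉1 : ¬ 0# ≈ 1#
      0≉1 = proj₁ isField

    ≉0-cancel : ∀ {u x} → ¬ u ≈ 0# → u * x ≈ 0# → x ≈ 0#
    ≉0-cancel {u} {x} u≉0 ux≈0 = begin
      x              ≈⟨ *-identityˡ x ⟨
      1# * x         ≈⟨ *-cong u*u⁻¹≈1 refl ⟨
      u * u⁻¹ * x    ≈⟨ solve 3 (λ u w x → u :* w :* x := w :* (u :* x)) refl u u⁻¹ x ⟩
      u⁻¹ * (u * x)  ≈⟨ *-cong refl ux≈0 ⟩
      u⁻¹ * 0#       ≈⟨ zeroʳ u⁻¹ ⟩
      0#             ∎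
      where
      u⁻¹ = proj₁ (proj₂ isField u u≉0)
      u*u⁻¹≈1 = proj₂ (proj₂ isField u u≉0)

    square≈0⇒≈0 : ∀ {x} → x * x ≈ 0# → x ≈ 0#
    square≈0⇒≈0 {x} xx≈0 with x ≟ 0#
    ... | yes x≈0 = x≈0
    ... | no x≉0  = ≉0-cancel x≉0 xx≈0

    nonzero-entry : ∀ {m n} {M : Mat m n} → ¬ M ≋ 0ᴹ → ∃₂ λ i j → ¬ M i j ≈ 0#
    nonzero-entry {m} {n} {M} M≉0 =
      let i , row≉0 = Fin.¬∀⟶∃¬ m (λ i → ∀ j → M i j ≈ 0#) (λ i → Fin.all? (λ j → M i j ≟ 0#)) M≉0
          j , Mij≉0 = Fin.¬∀⟶∃¬ n (λ j → M i j ≈ 0#) (λ j → M i j ≟ 0#) row≉0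
      in i , j , Mij≉0

    LinIndep-singleton : ∀ {m} {v : Fin 1 → Fin m → Carrier} k → ¬ v 0F k ≈ 0# → LinIndep v
    LinIndep-singleton k v≉0 c Σ≈0 0F = ≉0-cancel v≉0 (trans (*-comm _ _) (trans (sym (+-identityʳ _)) (Σ≈0 k)))

    ¬LinIndep⇒minors≈ : ∀ {m} (v : Fin 2 → Fin m → Carrier) → ¬ LinIndep v →
                        ∀ k l → v 0F k * v 1F l ≈ v 0F l * v 1F k
    ¬LinIndep⇒minors≈ v dependent k l with (v 0F k * v 1F l - v 0F l * v 1F k) ≟ 0#
    ... | yes minor≈0 = x∙y⁻¹≈ε⇒x≈y _ _ minor≈0
    ... | no minor≉0  = ⊥-elim (dependent cramer)
      where
      a = v 0F k; a' = v 0F l; b = v 1F k; b' = v 1F l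
      x*0-y*0≈0 : ∀ x y → x * 0# - y * 0# ≈ 0#
      x*0-y*0≈0 = solve 2 (λ x y → x :* con (+ 0) :- y :* con (+ 0) := con (+ 0)) refl
      cramer : LinIndep v
      cramer c Σ≈0 0F = ≉0-cancel minor≉0 (begin
        (a * b' - a' * b) * c 0F
          ≈⟨ solve 6 (λ c₀ c₁ a a' b b' → (a :* b' :- a' :* b) :* c₀
                      := b' :* (c₀ :* a :+ (c₁ :* b :+ con (+ 0))) :- b :* (c₀ :* a' :+ (c₁ :* b' :+ con (+ 0))))
                   refl (c 0F) (c 1F) a a' b b' ⟩
        b' * (c 0F * a + (c 1F * b + 0#)) - b * (c 0F * a' + (c 1F * b' + 0#))
          ≈⟨ +-cong (*-cong refl (Σ≈0 k)) (-‿cong (*-cong refl (Σ≈0 l))) ⟩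
        b' * 0# - b * 0#
          ≈⟨ x*0-y*0≈0 b' b ⟩
        0# ∎)
      cramer c Σ≈0 1F = ≉0-cancel minor≉0 (begin
        (a * b' - a' * b) * c 1F
          ≈⟨ solve 6 (λ c₀ c₁ a a' b b' → (a :* b' :- a' :* b) :* c₁
                      := a :* (c₀ :* a' :+ (c₁ :* b' :+ con (+ 0))) :- a' :* (c₀ :* a :+ (c₁ :* b :+ con (+ 0))))
                   refl (c 0F) (c 1F) a a' b b' ⟩
        a * (c 0F * a' + (c 1F * b' + 0#)) - a' * (c 0F * a + (c 1F * b + 0#))
          ≈⟨ +-cong (*-cong refl (Σ≈0 l)) (-‿cong (*-cong refl (Σ≈0 k))) ⟩
        a * 0# - a' * 0#
          ≈⟨ x*0-y*0≈0 a a' ⟩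
        0# ∎)

    Rank1⇔nonzero×Rank≤1 : ∀ {m n} (M : Mat m n) → Rank M 1 ⇔ (¬ M ≋ 0ᴹ × Rank≤1 M)
    Rank1⇔nonzero×Rank≤1 {m} {n} M = mk⇔ to from
      where
      columns : ∀ {k} → (Fin k → Fin n) → Fin k → Fin m → Carrier
      columns s a i = M i (s a)
      to : Rank M 1 → ¬ M ≋ 0ᴹ × Rank≤1 M
      to ((s , independent) , maximal) =
        (λ M≈0 → LinIndep-singleton⁻¹ 0≉1 {v = columns s} independent (λ i → M≈0 i (s 0F))) ,
        (λ i i' j j' → ¬LinIndep⇒minors≈ (columns (j ∷ j' ∷ [])) (maximal (j ∷ j' ∷ [])) i i')
      from : ¬ M ≋ 0ᴹ × Rank≤1 M → Rank M 1
      from (M≉0 , r) =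
        let i , j , Mij≉0 = nonzero-entry M≉0
        in ((λ _ → j) , LinIndep-singleton {v = columns (λ _ → j)} i Mij≉0) ,
           (λ s → minors≈⇒¬LinIndep 0≉1 (columns s) (λ k l → r k l (s 0F) (s 1F)))

    Rank≤1⇒outer : ∀ {m n} {M : Mat m n} {i₀ j₀} → ¬ M i₀ j₀ ≈ 0# → Rank≤1 M →
                   ∃ λ (v : Fin n → Carrier) → ∀ i j → M i j ≈ M i j₀ * v j
    Rank≤1⇒outer {M = M} {i₀} {j₀} pivot≉0 r = (λ j → M i₀ j * w) , factor
      where
      w = proj₁ (proj₂ isField (M i₀ j₀) pivot≉0)
      pivot*w≈1 = proj₂ (proj₂ isField (M i₀ j₀) pivot≉0)
      factor : ∀ i j → M i j ≈ M i j₀ * (M i₀ j * w)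
      factor i j = begin
        M i j                        ≈⟨ *-identityˡ (M i j) ⟨
        1# * M i j                   ≈⟨ *-cong pivot*w≈1 refl ⟨
        M i₀ j₀ * w * M i j          ≈⟨ solve 3 (λ p w x → p :* w :* x := w :* (p :* x)) refl (M i₀ j₀) w (M i j) ⟩
        w * (M i₀ j₀ * M i j)        ≈⟨ *-cong refl (r i₀ i j₀ j) ⟩
        w * (M i j₀ * M i₀ j)        ≈⟨ solve 3 (λ w x y → w :* (x :* y) := x :* (y :* w)) refl w (M i j₀) (M i₀ j) ⟩
        M i j₀ * (M i₀ j * w)        ∎

    -- The diagonal entries u i * v i vanish, and then (u i * v j)² = - (u i * v i) (u j * v j).
    outer-skew⇒zero : ∀ {h} → h + h ≈ 1# → ∀ {n} (u v : Fin n → Carrier) →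
                      (∀ i j → u i * v j + u j * v i ≈ 0#) → ∀ i j → u i * v j ≈ 0#
    outer-skew⇒zero h+h≈1 u v skew i j = square≈0⇒≈0 (begin
      u i * v j * (u i * v j)        ≈⟨ *-cong refl (+-inverseˡ-unique _ _ (skew i j)) ⟩
      u i * v j * - (u j * v i)      ≈⟨ solve 4 (λ a b c d → a :* d :* :- (c :* b) := :- (a :* b :* (c :* d)))
                                                refl (u i) (v i) (u j) (v j) ⟩
      - (u i * v i * (u j * v j))    ≈⟨ -‿cong (*-cong (diagonal i) refl) ⟩
      - (0# * (u j * v j))           ≈⟨ -‿cong (zeroˡ _) ⟩
      - 0#                           ≈⟨ -0#≈0# ⟩
      0#                             ∎)
      where
      diagonal : ∀ i → u i * v i ≈ 0#
      diagonal i = +-self≈0⇒≈0 h+h≈1 (skew i i)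

module Neighbourhood (F : CommutativeRing 0ℓ 0ℓ) where
  open CommutativeRing F hiding (zero)
  open Setup F
  open Matrices F
  open IntegerCoefficientSolver F using (Polynomial; solve; _:=_; _:+_; _:*_; _:-_; :-_; con)
  open import Algebra.Properties.Ring ring using (x∙y⁻¹≈ε⇒x≈y; x≈y⇒x∙y⁻¹≈ε)
  open import Relation.Binary.Reasoning.Setoid setoid

  module _ (z : Carrier) where

    Δ-form : (a₀ a₁ b₀ b₁ : Carrier) → Carrier
    Δ-form a₀ a₁ b₀ b₁ = a₀ * b₀ + (a₁ * - z) * b₁

    :Δ-form : ∀ {n} → (z a₀ a₁ b₀ b₁ : Polynomial n) → Polynomial n
    :Δ-form z a₀ a₁ b₀ b₁ = a₀ :* b₀ :+ (a₁ :* :- z) :* b₁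

    Δ-form-cong : ∀ {a₀ a₁ b₀ b₁ a₀' a₁' b₀' b₁'} → a₀ ≈ a₀' → a₁ ≈ a₁' → b₀ ≈ b₀' → b₁ ≈ b₁' →
                  Δ-form a₀ a₁ b₀ b₁ ≈ Δ-form a₀' a₁' b₀' b₁'
    Δ-form-cong e₀ e₁ e₂ e₃ = +-cong (*-cong e₀ e₂) (*-cong (*-cong e₁ refl) e₃)

    Δ-form-zeroˡ : ∀ {a₀ a₁} b₀ b₁ → a₀ ≈ 0# → a₁ ≈ 0# → Δ-form a₀ a₁ b₀ b₁ ≈ 0#
    Δ-form-zeroˡ b₀ b₁ e₀ e₁ = begin
      Δ-form _ _ b₀ b₁        ≈⟨ Δ-form-cong e₀ e₁ refl refl ⟩
      Δ-form 0# 0# b₀ b₁      ≈⟨ solve 3 (λ z b₀ b₁ → :Δ-form z (con (+ 0)) (con (+ 0)) b₀ b₁ := con (+ 0))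
                                         refl z b₀ b₁ ⟩
      0#                    ∎

    ⟪_,_⟫ : ∀ {ν} → Mat ν 2 → Mat ν 2 → Mat ν ν
    ⟪ P , Q ⟫ i j = Δ-form (P i 0F) (P i 1F) (Q j 0F) (Q j 1F)

    ⊗Δ⊗ᵗ≋⟪⟫ : ∀ {ν} (P Q : Mat ν 2) → ((P ⊗ Δ z) ⊗ (Q ᵗ)) ≋ ⟪ P , Q ⟫
    ⊗Δ⊗ᵗ≋⟪⟫ P Q i j = trans
      (solve 6 (λ a₀ a₁ b₀ b₁ z one →
         (a₀ :* one :+ (a₁ :* con (+ 0) :+ con (+ 0))) :* b₀
           :+ ((a₀ :* con (+ 0) :+ (a₁ :* :- z :+ con (+ 0))) :* b₁ :+ con (+ 0))
         := :Δ-form z (a₀ :* one) a₁ b₀ b₁) refl (P i 0F) (P i 1F) (Q j 0F) (Q j 1F) z 1#)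
      (Δ-form-cong (*-identityʳ _) refl refl refl)

    ⊗Δ⊗ᵗ-cong : ∀ {ν} {P P' Q Q' : Mat ν 2} → P ≋ P' → Q ≋ Q' → ((P ⊗ Δ z) ⊗ (Q ᵗ)) ≋ ((P' ⊗ Δ z) ⊗ (Q' ᵗ))
    ⊗Δ⊗ᵗ-cong {P = P} {P'} {Q} {Q'} P≋P' Q≋Q' i j = begin
      ((P ⊗ Δ z) ⊗ (Q ᵗ)) i j    ≈⟨ ⊗Δ⊗ᵗ≋⟪⟫ P Q i j ⟩
      ⟪ P , Q ⟫ i j              ≈⟨ Δ-form-cong (P≋P' i 0F) (P≋P' i 1F) (Q≋Q' j 0F) (Q≋Q' j 1F) ⟩
      ⟪ P' , Q' ⟫ i j            ≈⟨ ⊗Δ⊗ᵗ≋⟪⟫ P' Q' i j ⟨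
      ((P' ⊗ Δ z) ⊗ (Q' ᵗ)) i j  ∎

    InΛ-resp-≋ : ∀ {ν} {X X' : Mat ν ν} {Z Z' : Mat ν 2} → X ≋ X' → Z ≋ Z' → InΛ z X Z → InΛ z X' Z'
    InΛ-resp-≋ X≋X' Z≋Z' inΛ i j =
      trans (+-cong (+-cong (sym (X≋X' i j)) (sym (X≋X' j i))) (sym (⊗Δ⊗ᵗ-cong Z≋Z' Z≋Z' i j))) (inΛ i j)

    module Vertex (h : Carrier) (half : h * (1# + 1#) ≈ 1#)
                  {ν : ℕ} (A : Mat ν ν) (alternate : Alternate A) (C : Mat ν 2) where

      Xᴿ : Mat ν ν
      Xᴿ = A ⊖ (h ⊛ ((C ⊗ Δ z) ⊗ (C ᵗ)))

      X⁺ : Mat ν 2 → Mat ν ν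
      X⁺ D = A ⊖ (h ⊛ ((((C ⊗ Δ z) ⊗ (C ᵗ)) ⊕ ((D ⊗ Δ z) ⊗ (D ᵗ))) ⊕ ((1# + 1#) ⊛ ((D ⊗ Δ z) ⊗ (C ᵗ)))))

      h+h≈1 : h + h ≈ 1#
      h+h≈1 = trans (sym (x*2≈x+x h)) half

      x-[h+h]x≈0 : ∀ x → x - (h + h) * x ≈ 0#
      x-[h+h]x≈0 x = x≈y⇒x∙y⁻¹≈ε (trans (sym (*-identityˡ x)) (*-cong (sym h+h≈1) refl))

      Xᴿ-inΛ : InΛ z Xᴿ C
      Xᴿ-inΛ i j = begin
        (Xᴿ i j + Xᴿ j i) + ((C ⊗ Δ z) ⊗ (C ᵗ)) i j
          ≈⟨ +-cong (+-cong (Xᴿ≈ i j) (trans (Xᴿ≈ j i) (+-cong (proj₁ alternate i j) refl))) (⊗Δ⊗ᵗ≋⟪⟫ C C i j) ⟩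
        ((A i j - h * ⟪ C , C ⟫ i j) + (- A i j - h * ⟪ C , C ⟫ j i)) + ⟪ C , C ⟫ i j
          ≈⟨ solve 7 (λ a h z ci₀ ci₁ cj₀ cj₁ →
               ((a :- h :* :Δ-form z ci₀ ci₁ cj₀ cj₁) :+ (:- a :- h :* :Δ-form z cj₀ cj₁ ci₀ ci₁))
                 :+ :Δ-form z ci₀ ci₁ cj₀ cj₁
               := :Δ-form z ci₀ ci₁ cj₀ cj₁ :- (h :+ h) :* :Δ-form z ci₀ ci₁ cj₀ cj₁)
             refl (A i j) h z (C i 0F) (C i 1F) (C j 0F) (C j 1F) ⟩
        ⟪ C , C ⟫ i j - (h + h) * ⟪ C , C ⟫ i j
          ≈⟨ x-[h+h]x≈0 _ ⟩
        0# ∎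
        where
        Xᴿ≈ : ∀ i j → Xᴿ i j ≈ A i j - h * ⟪ C , C ⟫ i j
        Xᴿ≈ i j = +-cong refl (-‿cong (*-cong refl (⊗Δ⊗ᵗ≋⟪⟫ C C i j)))

      X⁺≈ : ∀ D i j → X⁺ D i j ≈ Xᴿ i j - (h * ⟪ D , D ⟫ i j + ⟪ D , C ⟫ i j)
      X⁺≈ D i j = begin
        X⁺ D i j
          ≈⟨ +-cong refl (-‿cong (*-cong refl (+-cong (+-cong (⊗Δ⊗ᵗ≋⟪⟫ C C i j) (⊗Δ⊗ᵗ≋⟪⟫ D D i j))
                                                       (*-cong refl (⊗Δ⊗ᵗ≋⟪⟫ D C i j))))) ⟩
        A i j - h * ((cc + dd) + (1# + 1#) * dc)
          ≈⟨ solve 6 (λ a h t cc dd dc → a :- h :* ((cc :+ dd) :+ t :* dc) := (a :- h :* cc) :- (h :* dd :+ h :* t :* dc))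
                   refl (A i j) h (1# + 1#) cc dd dc ⟩
        (A i j - h * cc) - (h * dd + h * (1# + 1#) * dc)
          ≈⟨ +-cong (sym (+-cong refl (-‿cong (*-cong refl (⊗Δ⊗ᵗ≋⟪⟫ C C i j)))))
                    (-‿cong (+-cong refl (trans (*-cong half refl) (*-identityˡ dc)))) ⟩
        Xᴿ i j - (h * dd + dc) ∎
        where
        cc = ⟪ C , C ⟫ i j
        dd = ⟪ D , D ⟫ i j
        dc = ⟪ D , C ⟫ i j

      X⁺-inΛ : ∀ D → InΛ z (X⁺ D) (C ⊕ D)
      X⁺-inΛ D i j = begin
        (X⁺ D i j + X⁺ D j i) + (((C ⊕ D) ⊗ Δ z) ⊗ ((C ⊕ D) ᵗ)) i j
          ≈⟨ +-cong (+-cong (X⁺≈ D i j) (X⁺≈ D j i)) (⊗Δ⊗ᵗ≋⟪⟫ (C ⊕ D) (C ⊕ D) i j) ⟩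
        ((Xᴿ i j - (h * ⟪ D , D ⟫ i j + ⟪ D , C ⟫ i j)) + (Xᴿ j i - (h * ⟪ D , D ⟫ j i + ⟪ D , C ⟫ j i)))
          + ⟪ C ⊕ D , C ⊕ D ⟫ i j
          ≈⟨ solve 12 (λ r r' h z ci₀ ci₁ cj₀ cj₁ di₀ di₁ dj₀ dj₁ →
               ((r :- (h :* :Δ-form z di₀ di₁ dj₀ dj₁ :+ :Δ-form z di₀ di₁ cj₀ cj₁))
                 :+ (r' :- (h :* :Δ-form z dj₀ dj₁ di₀ di₁ :+ :Δ-form z dj₀ dj₁ ci₀ ci₁)))
                 :+ :Δ-form z (ci₀ :+ di₀) (ci₁ :+ di₁) (cj₀ :+ dj₀) (cj₁ :+ dj₁)
               := ((r :+ r') :+ :Δ-form z ci₀ ci₁ cj₀ cj₁)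
                    :+ (:Δ-form z di₀ di₁ dj₀ dj₁ :- (h :+ h) :* :Δ-form z di₀ di₁ dj₀ dj₁))
             refl (Xᴿ i j) (Xᴿ j i) h z (C i 0F) (C i 1F) (C j 0F) (C j 1F) (D i 0F) (D i 1F) (D j 0F) (D j 1F) ⟩
        ((Xᴿ i j + Xᴿ j i) + ⟪ C , C ⟫ i j) + (⟪ D , D ⟫ i j - (h + h) * ⟪ D , D ⟫ i j)
          ≈⟨ +-cong (trans (+-cong refl (sym (⊗Δ⊗ᵗ≋⟪⟫ C C i j))) (Xᴿ-inΛ i j)) (x-[h+h]x≈0 _) ⟩
        0# + 0#
          ≈⟨ +-identityʳ 0# ⟩
        0# ∎

      module Adjacency (isField : IsField) (_≟_ : ∀ x y → Dec (x ≈ y)) where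
        open OverField isField _≟_

        module Backward {X : Mat ν ν} {Z : Mat ν 2} (D : Mat ν 2) (rankD : Rank D 1)
                        (X≋ : X ≋ X⁺ D) (Z≋ : Z ≋ (C ⊕ D)) where
          M : Mat ν (ν ℕ.+ 2)
          M = [ X ⊖ Xᴿ ∣ Z ⊖ C ]

          D≉0 : ¬ D ≋ 0ᴹ
          D≉0 = proj₁ (Equivalence.to (Rank1⇔nonzero×Rank≤1 D) rankD)

          -- X⁺ D - Xᴿ = - D Δ (h D + C)ᵗ, so N = - Δ (h D + C)ᵗ.
          N : Mat 2 ν
          N 0F a = - (h * D a 0F + C a 0F)
          N 1F a = z * (h * D a 1F + C a 1F)

          I₂ : Mat 2 2
          I₂ 0F 0F = 1#
          I₂ 0F 1F = 0#
          I₂ 1F 0F = 0#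
          I₂ 1F 1F = 1#

          Rank≤1-D⊗[N∣I] : Rank≤1 (D ⊗ [ N ∣ I₂ ])
          Rank≤1-D⊗[N∣I] = Rank≤1-⊗ D [ N ∣ I₂ ] (proj₂ (Equivalence.to (Rank1⇔nonzero×Rank≤1 D) rankD))

          Z-C≈D : ∀ i b → Z i b - C i b ≈ D i b
          Z-C≈D i b = trans (+-cong (Z≋ i b) refl) (solve 2 (λ c d → c :+ d :- c := d) refl (C i b) (D i b))

          factorisation : (D ⊗ [ N ∣ I₂ ]) ≋ M
          factorisation i j with splitAt ν j
          ... | inj₁ a = sym (begin
            X i a - Xᴿ i a
              ≈⟨ +-cong (trans (X≋ i a) (X⁺≈ D i a)) refl ⟩
            (Xᴿ i a - (h * ⟪ D , D ⟫ i a + ⟪ D , C ⟫ i a)) - Xᴿ i a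
              ≈⟨ solve 9 (λ r h z di₀ di₁ da₀ da₁ ca₀ ca₁ →
                   (r :- (h :* :Δ-form z di₀ di₁ da₀ da₁ :+ :Δ-form z di₀ di₁ ca₀ ca₁)) :- r
                   := di₀ :* (:- (h :* da₀ :+ ca₀)) :+ (di₁ :* (z :* (h :* da₁ :+ ca₁)) :+ con (+ 0)))
                 refl (Xᴿ i a) h z (D i 0F) (D i 1F) (D a 0F) (D a 1F) (C a 0F) (C a 1F) ⟩
            (D ⊗ N) i a ∎)
          ... | inj₂ 0F = trans (+-cong (*-identityʳ _) (trans (+-identityʳ _) (zeroʳ _)))
                                (trans (+-identityʳ _) (sym (Z-C≈D i 0F)))
          ... | inj₂ 1F = trans (+-cong (zeroʳ _) (trans (+-identityʳ _) (*-identityʳ _)))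
                                (trans (+-identityˡ _) (sym (Z-C≈D i 1F)))

          M≉0 : ¬ M ≋ 0ᴹ
          M≉0 M≈0 = D≉0 (λ i b → begin
            D i b             ≈⟨ Z-C≈D i b ⟨
            Z i b - C i b     ≡⟨ [∣]-↑ʳ (X ⊖ Xᴿ) (Z ⊖ C) i b ⟨
            M i (ν ↑ʳ b)      ≈⟨ M≈0 i (ν ↑ʳ b) ⟩
            0#                ∎)

          inΛR : InΛR z Xᴿ C X Z
          inΛR = InΛ-resp-≋ (λ i j → sym (X≋ i j)) (λ i b → sym (Z≋ i b)) (X⁺-inΛ D) ,
                 Equivalence.from (Rank1⇔nonzero×Rank≤1 M) (M≉0 , Rank≤1-resp-≋ factorisation Rank≤1-D⊗[N∣I])

        module Forward {X : Mat ν ν} {Z : Mat ν 2} (inΛ : InΛ z X Z) (adjacent : Adj X Z Xᴿ C) where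
          D : Mat ν 2
          D = Z ⊖ C

          M : Mat ν (ν ℕ.+ 2)
          M = [ X ⊖ Xᴿ ∣ D ]

          E : Mat ν ν
          E = X ⊖ X⁺ D

          M≉0 : ¬ M ≋ 0ᴹ
          M≉0 = proj₁ (Equivalence.to (Rank1⇔nonzero×Rank≤1 M) adjacent)

          Rank≤1-M : Rank≤1 M
          Rank≤1-M = proj₂ (Equivalence.to (Rank1⇔nonzero×Rank≤1 M) adjacent)

          Z≋C⊕D : Z ≋ (C ⊕ D)
          Z≋C⊕D i b = solve 2 (λ z c → z := c :+ (z :- c)) refl (Z i b) (C i b)

          E≈ : ∀ i j → E i j ≈ (X i j - Xᴿ i j) + (h * ⟪ D , D ⟫ i j + ⟪ D , C ⟫ i j)
          E≈ i j = trans (+-cong refl (-‿cong (X⁺≈ D i j)))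
                         (solve 3 (λ x r w → x :- (r :- w) := (x :- r) :+ w) refl (X i j) (Xᴿ i j) _)

          E-skew : ∀ i j → E i j + E j i ≈ 0#
          E-skew i j = begin
            (X i j - X⁺ D i j) + (X j i - X⁺ D j i)
              ≈⟨ solve 5 (λ a b c d e → (a :- b) :+ (c :- d) := ((a :+ c) :+ e) :- ((b :+ d) :+ e))
                       refl (X i j) (X⁺ D i j) (X j i) (X⁺ D j i) (((Z ⊗ Δ z) ⊗ (Z ᵗ)) i j) ⟩
            ((X i j + X j i) + ((Z ⊗ Δ z) ⊗ (Z ᵗ)) i j) - ((X⁺ D i j + X⁺ D j i) + ((Z ⊗ Δ z) ⊗ (Z ᵗ)) i j)
              ≈⟨ x≈y⇒x∙y⁻¹≈ε (trans (inΛ i j) (sym (X⁺-inΛ′ i j))) ⟩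
            0# ∎
            where
            X⁺-inΛ′ : InΛ z (X⁺ D) Z
            X⁺-inΛ′ = InΛ-resp-≋ (λ _ _ → refl) (λ i b → sym (Z≋C⊕D i b)) (X⁺-inΛ D)

          pivot : ∃₂ λ i j → ¬ M i j ≈ 0#
          pivot = nonzero-entry M≉0

          u : Fin ν → Carrier
          u i = M i (proj₁ (proj₂ pivot))

          v : Fin (ν ℕ.+ 2) → Carrier
          v = proj₁ (Rank≤1⇒outer (proj₂ (proj₂ pivot)) Rank≤1-M)

          M≈uv : ∀ i j → M i j ≈ u i * v j
          M≈uv = proj₂ (Rank≤1⇒outer (proj₂ (proj₂ pivot)) Rank≤1-M)

          μ : Fin ν → Carrier
          μ j = v (j ↑ˡ 2) + (h * Δ-form w₀ w₁ (D j 0F) (D j 1F) + Δ-form w₀ w₁ (C j 0F) (C j 1F))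
            where
            w₀ = v (ν ↑ʳ 0F)
            w₁ = v (ν ↑ʳ 1F)

          E≈uμ : ∀ i j → E i j ≈ u i * μ j
          E≈uμ i j = begin
            E i j
              ≈⟨ E≈ i j ⟩
            (X i j - Xᴿ i j) + (h * ⟪ D , D ⟫ i j + ⟪ D , C ⟫ i j)
              ≈⟨ +-cong (left j) (+-cong (*-cong refl (Δ-form-cong (right 0F) (right 1F) refl refl))
                                         (Δ-form-cong (right 0F) (right 1F) refl refl)) ⟩
            u i * v (j ↑ˡ 2) + (h * Δ-form (u i * w₀) (u i * w₁) (D j 0F) (D j 1F)
                                   + Δ-form (u i * w₀) (u i * w₁) (C j 0F) (C j 1F))
              ≈⟨ solve 10 (λ u l h z w₀ w₁ d₀ d₁ c₀ c₁ →
                   u :* l :+ (h :* :Δ-form z (u :* w₀) (u :* w₁) d₀ d₁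
                                :+ :Δ-form z (u :* w₀) (u :* w₁) c₀ c₁)
                   := u :* (l :+ (h :* :Δ-form z w₀ w₁ d₀ d₁ :+ :Δ-form z w₀ w₁ c₀ c₁)))
                 refl (u i) (v (j ↑ˡ 2)) h z w₀ w₁ (D j 0F) (D j 1F) (C j 0F) (C j 1F) ⟩
            u i * μ j ∎
            where
            w₀ = v (ν ↑ʳ 0F)
            w₁ = v (ν ↑ʳ 1F)
            left : ∀ a → X i a - Xᴿ i a ≈ u i * v (a ↑ˡ 2)
            left a = trans (reflexive (≡.sym ([∣]-↑ˡ (X ⊖ Xᴿ) D i a))) (M≈uv i (a ↑ˡ 2))
            right : ∀ b → D i b ≈ u i * v (ν ↑ʳ b)
            right b = trans (reflexive (≡.sym ([∣]-↑ʳ (X ⊖ Xᴿ) D i b))) (M≈uv i (ν ↑ʳ b))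

          E≋0 : E ≋ 0ᴹ
          E≋0 i j = trans (E≈uμ i j) (outer-skew⇒zero h+h≈1 u μ uμ-skew i j)
            where
            uμ-skew : ∀ i j → u i * μ j + u j * μ i ≈ 0#
            uμ-skew i j = trans (sym (+-cong (E≈uμ i j) (E≈uμ j i))) (E-skew i j)

          X≋X⁺ : X ≋ X⁺ D
          X≋X⁺ i j = x∙y⁻¹≈ε⇒x≈y _ _ (E≋0 i j)

          Rank≤1-D : Rank≤1 D
          Rank≤1-D = Rank≤1-resp-≋ (λ i b → reflexive ([∣]-↑ʳ (X ⊖ Xᴿ) D i b)) (Rank≤1-columns (ν ↑ʳ_) Rank≤1-M)

          D≉0 : ¬ D ≋ 0ᴹ
          D≉0 D≈0 = M≉0 M≈0
            where
            D-terms≈0 : ∀ i a → h * ⟪ D , D ⟫ i a + ⟪ D , C ⟫ i a ≈ 0#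
            D-terms≈0 i a = begin
              h * ⟪ D , D ⟫ i a + ⟪ D , C ⟫ i a ≈⟨ +-cong (*-cong refl (Δ-form-zeroˡ _ _ (D≈0 i 0F) (D≈0 i 1F)))
                                                          (Δ-form-zeroˡ _ _ (D≈0 i 0F) (D≈0 i 1F)) ⟩
              h * 0# + 0#                       ≈⟨ +-cong (zeroʳ h) refl ⟩
              0# + 0#                           ≈⟨ +-identityʳ 0# ⟩
              0#                                ∎
            M≈0 : M ≋ 0ᴹ
            M≈0 i j with splitAt ν j
            ... | inj₂ b = D≈0 i b
            ... | inj₁ a = begin
              X i a - Xᴿ i a                                         ≈⟨ +-identityʳ _ ⟨
              (X i a - Xᴿ i a) + 0#                                  ≈⟨ +-cong refl (D-terms≈0 i a) ⟨
              (X i a - Xᴿ i a) + (h * ⟪ D , D ⟫ i a + ⟪ D , C ⟫ i a) ≈⟨ E≈ i a ⟨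
              E i a                                                  ≈⟨ E≋0 i a ⟩
              0#                                                     ∎

          neighbour : ∃ λ (D : Mat ν 2) → Rank D 1 × X ≋ X⁺ D × Z ≋ (C ⊕ D)
          neighbour = D , Equivalence.from (Rank1⇔nonzero×Rank≤1 D) (D≉0 , Rank≤1-D) , X≋X⁺ , Z≋C⊕D

module _ (F : CommutativeRing 0ℓ 0ℓ) where
  open CommutativeRing F
  open Setup F

  ≈-decidable : ∀ {q} → HasOrder q → ∀ x y → Dec (x ≈ y)
  ≈-decidable (f , f-injective , f-surjective) x y with f-surjective x | f-surjective y
  ... | i , fi≈x | j , fj≈y with i Fin.≟ j
  ...   | yes ≡.refl = yes (trans (sym fi≈x) fj≈y)
  ...   | no i≢j     = no (λ x≈y → i≢j (f-injective i j (trans fi≈x (trans x≈y (sym fj≈y)))))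

-- The non-square conditions on z and 1 - z (and the oddness of q) are not needed:
-- the description of Λ(R) holds for every z as soon as 2 is invertible.
lemma3p1 : (F : CommutativeRing 0ℓ 0ℓ) →
    let open CommutativeRing F
        open Setup F
    in IsFiniteFieldOddOrder →
       (z : Carrier) → NonSquare z → NonSquare (1# - z) →
       (half : Carrier) → half * (1# + 1#) ≈ 1# →
       (ν : ℕ) (A : Mat ν ν) → Alternate A → (C : Mat ν 2) →
       (X : Mat ν ν) (Z : Mat ν 2) →
       InΛR z (A ⊖ (half ⊛ ((C ⊗ Δ z) ⊗ (C ᵗ)))) C X Z
       ⇔ (∃ λ (D : Mat ν 2) → Rank D 1 ×
            (X ≋ (A ⊖ (half ⊛ ((((C ⊗ Δ z) ⊗ (C ᵗ)) ⊕ ((D ⊗ Δ z) ⊗ (D ᵗ)))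
                               ⊕ ((1# + 1#) ⊛ ((D ⊗ Δ z) ⊗ (C ᵗ))))))
             × (Z ≋ (C ⊕ D))))
lemma3p1 F (isField , _ , _ , order) z _ _ h half ν A alternate C X Z =
  mk⇔ (λ (inΛ , adjacent) → Forward.neighbour inΛ adjacent)
      (λ (D , rankD , X≋ , Z≋) → Backward.inΛR D rankD X≋ Z≋)
  where open Neighbourhood.Vertex.Adjacency F z h half A alternate C isField (≈-decidable F order)
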